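{- Let $\pi=[\pi_1,\dots,\pi_n]$ be a permutation of $\{1,\dots,n\}$, extended by $\pi_0=0$ and $\pi_{n+1}=n+1$. Applying a monotone block move to $\pi$ decreases the number of inverse descents by at most one and decreases the number of inverse gaps by at most two.
   Context: A block move $(i,j,k)$ with $1\le i\le j<k\le n$ maps $[\dots\pi_{i-1}\,\pi_i\dots\pi_j\,\pi_{j+1}\dots\pi_k\,\pi_{k+1}\dots]$ to $[\dots\pi_{i-1}\,\pi_{j+1}\dots\pi_k\,\pi_i\dots\pi_j\,\pi_{k+1}\dots]$. It is monotone if $\pi_q>\pi_r$ for all $i\le q\le j<r\le k$. An inverse descent of $\pi$ is a pair of elements with $\pi_i=\pi_j+1$ and $i<j$; an inverse gap is a pair of elements with $\pi_i=\pi_j+1$ and $i>j+1$ (indices ranging over $0,\dots,n+1$). -}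

module Defs where

open import Data.Nat using (ℕ; zero; suc; _+_; _∸_; _<_; _≤_; _≟_; _<?_)
open import Data.List using (List; []; _∷_; _++_; [_]; take; drop; length; filter; cartesianProduct; upTo; applyUpTo)
open import Data.List.Relation.Unary.All using (All)
open import Data.List.Relation.Binary.Permutation.Propositional using (_↭_)
open import Data.Product using (_×_; _,_; proj₁; proj₂)
open import Relation.Nullary.Decidable using (_×-dec_)
open import Relation.Binary.PropositionalEquality using (_≡_)

IsPerm : ℕ → List ℕ → Set
IsPerm n π = π ↭ applyUpTo suc n

extend : ℕ → List ℕ → List ℕ
extend n π = 0 ∷ π ++ [ suc n ]

-- value at (0-based) position; default 0 outside range (only used in range)
at : List ℕ → ℕ → ℕ
at []       _       = 0
at (x ∷ xs) zero    = x
at (x ∷ xs) (suc i) = at xs i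

pairs : List ℕ → List (ℕ × ℕ)
pairs σ = cartesianProduct (upTo (length σ)) (upTo (length σ))

invDes : ℕ → List ℕ → ℕ
invDes n π = length (filter (λ p → (at σ (proj₁ p) ≟ suc (at σ (proj₂ p))) ×-dec (proj₁ p <? proj₂ p)) (pairs σ))
  where σ = extend n π

invGap : ℕ → List ℕ → ℕ
invGap n π = length (filter (λ p → (at σ (proj₁ p) ≟ suc (at σ (proj₂ p))) ×-dec (suc (proj₂ p) <? proj₁ p)) (pairs σ))
  where σ = extend n π

-- the entries π_a … π_b (1-based, inclusive); slice π a b = [π_a,…,π_b]
slice : List ℕ → ℕ → ℕ → List ℕ
slice π a b = drop (a ∸ 1) (take b π)

blockMove : List ℕ → ℕ → ℕ → ℕ → List ℕ
blockMove π i j k = take (i ∸ 1) π ++ slice π (suc j) k ++ slice π i j ++ drop k π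

ValidBM : ℕ → ℕ → ℕ → ℕ → Set
ValidBM n i j k = (1 ≤ i) × (i ≤ j) × (j < k) × (k ≤ n)

Monotone : List ℕ → ℕ → ℕ → ℕ → Set
Monotone π i j k = All (λ x → All (λ y → y < x) (slice π (suc j) k)) (slice π i j)

-- Let σ = [π₀, π₁, …, πₙ₊₁].  The block move (i,j,k) cuts σ as X U V Y with U = πᵢ…πⱼ and
-- V = πⱼ₊₁…πₖ, and returns X V U Y; the relative order of two entries changes only when one
-- lies in U and the other in V.  Monotonicity says V lies entirely below U.  Hence the only
-- inverse descent that can be lost is the single pair (min U, max V).  Inverse gaps are the
-- pairs "x before x + 1" that are not adjacent.  No such pair has x in U and x + 1 in V, so the
-- number of pairs "x before x + 1" can only grow, by the pairs from V × U.  Adjacency changes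
-- only at the three cut points: the new cut V|U is a pair from V × U already paid for by that
-- growth, and the other two new cuts cost at most one inverse gap each.
module Submission where

open import Defs
open import Data.Nat using (ℕ; _+_; _≤_)
open import Data.List using (List)
open import Data.Product using (_×_)

open import Data.Bool using (Bool; true; false; _∧_)
open import Data.Nat using (zero; suc; _*_; _⊓_; _<_; _∸_; z≤n; s≤s; z<s; _≟_; _<?_)
open import Data.Nat.Properties
open import Algebra.Properties.CommutativeSemigroup +-commutativeSemigroup using (interchange)
open import Data.Nat.ListAction using (sum)
open import Data.Nat.ListAction.Properties using (sum-++)
open import Data.Nat.Tactic.RingSolver using (solve-∀)
open import Data.List using ([]; _∷_; _++_; [_]; take; drop; length; filter; map; cartesianProduct; applyUpTo; upTo)
open import Data.List.Properties using (map-++; map-cong; map-∘; ++-assoc; take++drop≡id; take-take)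
open import Data.List.Membership.Propositional using (_∈_)
open import Data.List.Relation.Unary.All as All using (All)
open import Data.List.Relation.Unary.Any using (here; there)
open import Data.List.Relation.Unary.AllPairs using (_∷_)
open import Data.List.Relation.Unary.Unique.Propositional using (Unique)
open import Data.List.Relation.Unary.Unique.Propositional.Properties using (applyUpTo⁺₁; take⁺; drop⁺)
open import Data.List.Relation.Binary.Permutation.Propositional using (↭-sym; ↭⇒↭ₛ)
open import Data.Product using (_,_; ∃)
open import Function using (_∘_; id; flip)
open import Relation.Nullary using (Dec; yes; no; does; ¬_; contradiction; _×-dec_)
open import Relation.Unary using (Decidable)
open import Relation.Binary.PropositionalEquality
  using (_≡_; refl; sym; trans; cong; cong₂; subst; setoid; module ≡-Reasoning)
open import Data.List.Relation.Binary.Permutation.Setoid.Properties (setoid ℕ) using (Unique-resp-↭)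

𝟙 : Bool → ℕ
𝟙 true  = 1
𝟙 false = 0

𝟙≤1 : ∀ b → 𝟙 b ≤ 1
𝟙≤1 true  = s≤s z≤n
𝟙≤1 false = z≤n

𝟙-∧ : ∀ b c → 𝟙 (b ∧ c) ≡ 𝟙 b * 𝟙 c
𝟙-∧ true  c = sym (+-identityʳ (𝟙 c))
𝟙-∧ false c = refl

𝟙-∧-<? : ∀ b {m m′} q → m ≡ m′ → 𝟙 (b ∧ does (m <? q)) ≡ 𝟙 b * 𝟙 (does (m′ <? q))
𝟙-∧-<? b q refl = 𝟙-∧ b _

𝟙-does-no : {P : Set} (P? : Dec P) → ¬ P → 𝟙 (does P?) ≡ 0
𝟙-does-no (yes p) ¬p = contradiction p ¬p
𝟙-does-no (no _)  _  = refl

𝟙-does-witness : {P : Set} (P? : Dec P) → 0 < 𝟙 (does P?) → P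
𝟙-does-witness (yes p) _  = p
𝟙-does-witness (no _)  ()

module _ {A : Set} where

  ∑ : (A → ℕ) → List A → ℕ
  ∑ f xs = sum (map f xs)

  ∑-++ : ∀ f xs ys → ∑ f (xs ++ ys) ≡ ∑ f xs + ∑ f ys
  ∑-++ f xs ys = trans (cong sum (map-++ f xs ys)) (sum-++ (map f xs) (map f ys))

  ∑-cong : ∀ {f g : A → ℕ} → (∀ x → f x ≡ g x) → ∀ xs → ∑ f xs ≡ ∑ g xs
  ∑-cong f≗g xs = cong sum (map-cong f≗g xs)

  ∑-+ : ∀ f g xs → ∑ (λ x → f x + g x) xs ≡ ∑ f xs + ∑ g xs
  ∑-+ f g []       = refl
  ∑-+ f g (x ∷ xs) = trans (cong (f x + g x +_) (∑-+ f g xs)) (interchange (f x) (g x) _ _)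

  ∑-zero : ∀ {f} xs → (∀ {x} → x ∈ xs → f x ≡ 0) → ∑ f xs ≡ 0
  ∑-zero []       _    = refl
  ∑-zero (x ∷ xs) f≡0 = cong₂ _+_ (f≡0 (here refl)) (∑-zero xs (f≡0 ∘ there))

  ∑-positive : ∀ {f} xs → 0 < ∑ f xs → ∃ λ x → x ∈ xs × 0 < f x
  ∑-positive {f} (x ∷ xs) 0<∑ with f x in fx
  ... | suc _ = x , here refl , subst (0 <_) (sym fx) z<s
  ... | zero with ∑-positive xs 0<∑
  ...   | y , y∈xs , 0<fy = y , there y∈xs , 0<fy

  ∑-≤1 : ∀ {f xs} → Unique xs → (∀ x → f x ≤ 1) →
         (∀ {x y} → x ∈ xs → y ∈ xs → 0 < f x → 0 < f y → x ≡ y) → ∑ f xs ≤ 1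
  ∑-≤1 {xs = []}     _            _   _       = z≤n
  ∑-≤1 {f} {x ∷ xs} (x∉xs ∷ uxs) f≤1 unique with f x in fx
  ... | zero  = ∑-≤1 uxs f≤1 (λ p q → unique (there p) (there q))
  ... | suc m = begin
    suc m + ∑ f xs ≡⟨ cong (suc m +_) (∑-zero xs fy≡0) ⟩
    suc m + 0      ≡⟨ +-identityʳ (suc m) ⟩
    suc m          ≡⟨ fx ⟨
    f x            ≤⟨ f≤1 x ⟩
    1              ∎
    where
    open ≤-Reasoning
    0<fx : 0 < f x
    0<fx = subst (0 <_) (sym fx) z<s
    fy≡0 : ∀ {y} → y ∈ xs → f y ≡ 0
    fy≡0 {y} y∈xs with f y in fy
    ... | zero  = refl
    ... | suc _ = contradiction (unique (here refl) (there y∈xs) 0<fx (subst (0 <_) (sym fy) z<s))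
                                (All.lookup x∉xs y∈xs)

  length-filter : ∀ {P : A → Set} (P? : Decidable P) xs → length (filter P? xs) ≡ ∑ (𝟙 ∘ does ∘ P?) xs
  length-filter P? []       = refl
  length-filter P? (x ∷ xs) with does (P? x)
  ... | true  = cong suc (length-filter P? xs)
  ... | false = length-filter P? xs

∑-cartesianProduct : ∀ {A B : Set} (f : A × B → ℕ) U V →
  ∑ f (cartesianProduct U V) ≡ ∑ (λ u → ∑ (λ v → f (u , v)) V) U
∑-cartesianProduct f []      V = refl
∑-cartesianProduct f (u ∷ U) V = trans (∑-++ f (map (u ,_) V) (cartesianProduct U V))
  (cong₂ _+_ (cong sum (sym (map-∘ V))) (∑-cartesianProduct f U V))

∑< : ℕ → (ℕ → ℕ) → ℕ
∑< zero    f = 0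
∑< (suc L) f = f 0 + ∑< L (f ∘ suc)

∑<-cong : ∀ {f g} → (∀ p → f p ≡ g p) → ∀ L → ∑< L f ≡ ∑< L g
∑<-cong f≗g zero    = refl
∑<-cong f≗g (suc L) = cong₂ _+_ (f≗g 0) (∑<-cong (f≗g ∘ suc) L)

∑<-+ : ∀ f g L → ∑< L (λ p → f p + g p) ≡ ∑< L f + ∑< L g
∑<-+ f g zero    = refl
∑<-+ f g (suc L) = trans (cong (f 0 + g 0 +_) (∑<-+ (f ∘ suc) (g ∘ suc) L)) (interchange (f 0) (g 0) _ _)

∑<-zero : ∀ L → ∑< L (λ _ → 0) ≡ 0
∑<-zero zero    = refl
∑<-zero (suc L) = ∑<-zero L

∑<-comm : ∀ (F : ℕ → ℕ → ℕ) L M → ∑< L (λ p → ∑< M (F p)) ≡ ∑< M (λ q → ∑< L (λ p → F p q))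
∑<-comm F zero    M = sym (∑<-zero M)
∑<-comm F (suc L) M = trans (cong (∑< M (F 0) +_) (∑<-comm (F ∘ suc) L M))
                            (sym (∑<-+ (F 0) (λ q → ∑< L (λ p → F (suc p) q)) M))

∑-applyUpTo : ∀ {A : Set} (f : A → ℕ) h L → ∑ f (applyUpTo h L) ≡ ∑< L (f ∘ h)
∑-applyUpTo f h zero    = refl
∑-applyUpTo f h (suc L) = cong (f (h 0) +_) (∑-applyUpTo f (h ∘ suc) L)

∑<-at : ∀ g xs → ∑< (length xs) (g ∘ at xs) ≡ ∑ g xs
∑<-at g []       = refl
∑<-at g (x ∷ xs) = cong (g x +_) (∑<-at g xs)

length-filter-pairs : ∀ {P : ℕ × ℕ → Set} (P? : Decidable P) σ →
  length (filter P? (pairs σ)) ≡ ∑< (length σ) (λ p → ∑< (length σ) (λ q → 𝟙 (does (P? (p , q)))))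
length-filter-pairs P? σ = begin
  length (filter P? (pairs σ))                                      ≡⟨ length-filter P? (pairs σ) ⟩
  ∑ (𝟙 ∘ does ∘ P?) (pairs σ)                                       ≡⟨ ∑-cartesianProduct _ (upTo L) (upTo L) ⟩
  ∑ (λ p → ∑ (λ q → 𝟙 (does (P? (p , q)))) (upTo L)) (upTo L)
    ≡⟨ ∑-applyUpTo _ id L ⟩
  ∑< L (λ p → ∑ (λ q → 𝟙 (does (P? (p , q)))) (upTo L))    ≡⟨ ∑<-cong (λ p → ∑-applyUpTo _ id L) L ⟩
  ∑< L (λ p → ∑< L (λ q → 𝟙 (does (P? (p , q)))))                  ∎
  where
  open ≡-Reasoning
  L = length σ

-- Counting ordered pairs of entries of a list

module _ {A : Set} (R : A → A → Bool) where

  weight : A → A → ℕ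
  weight x y = 𝟙 (R x y)

  farPairs : ℕ → List A → ℕ
  farPairs d []       = 0
  farPairs d (x ∷ xs) = ∑ (weight x) (drop d xs) + farPairs d xs

  adjacentPairs : List A → ℕ
  adjacentPairs []           = 0
  adjacentPairs (x ∷ [])     = 0
  adjacentPairs (x ∷ y ∷ xs) = weight x y + adjacentPairs (y ∷ xs)

  crossPairs : List A → List A → ℕ
  crossPairs U V = ∑ (λ u → ∑ (weight u) V) U

  -- the pair (last U, head V) made adjacent by concatenating U and V
  junction : List A → List A → ℕ
  junction []           V       = 0
  junction (u ∷ [])     []      = 0
  junction (u ∷ [])     (v ∷ V) = weight u v
  junction (u ∷ u′ ∷ U) V       = junction (u′ ∷ U) V

  farPairs₁+adjacentPairs : ∀ xs → farPairs 1 xs + adjacentPairs xs ≡ farPairs 0 xs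
  farPairs₁+adjacentPairs []           = refl
  farPairs₁+adjacentPairs (x ∷ [])     = refl
  farPairs₁+adjacentPairs (x ∷ y ∷ xs) = begin
    (∑ (weight x) xs + farPairs 1 (y ∷ xs)) + (weight x y + adjacentPairs (y ∷ xs))
      ≡⟨ interchange (∑ (weight x) xs) _ (weight x y) _ ⟩
    (∑ (weight x) xs + weight x y) + (farPairs 1 (y ∷ xs) + adjacentPairs (y ∷ xs))
      ≡⟨ cong₂ _+_ (+-comm (∑ (weight x) xs) (weight x y)) (farPairs₁+adjacentPairs (y ∷ xs)) ⟩
    (weight x y + ∑ (weight x) xs) + farPairs 0 (y ∷ xs) ∎
    where open ≡-Reasoning

  crossPairs-++ʳ : ∀ U V W → crossPairs U (V ++ W) ≡ crossPairs U V + crossPairs U W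
  crossPairs-++ʳ U V W = trans (∑-cong (λ u → ∑-++ (weight u) V W) U) (∑-+ _ _ U)

  farPairs₀-++ : ∀ U V → farPairs 0 (U ++ V) ≡ farPairs 0 U + farPairs 0 V + crossPairs U V
  farPairs₀-++ []      V = sym (+-identityʳ (farPairs 0 V))
  farPairs₀-++ (u ∷ U) V = trans (cong₂ _+_ (∑-++ (weight u) U V) (farPairs₀-++ U V))
                                 (regroup (∑ (weight u) U) (∑ (weight u) V) _ _ _)
    where
    regroup : ∀ a b c d e → (a + b) + ((c + d) + e) ≡ ((a + c) + d) + (b + e)
    regroup = solve-∀

  adjacentPairs-++ : ∀ U V → adjacentPairs (U ++ V) ≡ adjacentPairs U + adjacentPairs V + junction U V
  adjacentPairs-++ []           V       = sym (+-identityʳ (adjacentPairs V))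
  adjacentPairs-++ (u ∷ [])     []      = refl
  adjacentPairs-++ (u ∷ [])     (v ∷ V) = +-comm (weight u v) (adjacentPairs (v ∷ V))
  adjacentPairs-++ (u ∷ u′ ∷ U) V       = trans (cong (weight u u′ +_) (adjacentPairs-++ (u′ ∷ U) V))
                                                (regroup (weight u u′) _ _ _)
    where
    regroup : ∀ a b c d → a + ((b + c) + d) ≡ ((a + b) + c) + d
    regroup = solve-∀

  junction≤1 : ∀ U V → junction U V ≤ 1
  junction≤1 []           V       = z≤n
  junction≤1 (u ∷ [])     []      = z≤n
  junction≤1 (u ∷ [])     (v ∷ V) = 𝟙≤1 (R u v)
  junction≤1 (u ∷ u′ ∷ U) V       = junction≤1 (u′ ∷ U) V

  junction-++ʳ : ∀ U V W → junction U (V ++ W) ≤ junction U W + crossPairs U V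
  junction-++ʳ []           V       W = z≤n
  junction-++ʳ (u ∷ [])     []      W = m≤m+n (junction (u ∷ []) W) 0
  junction-++ʳ (u ∷ [])     (v ∷ V) W =
    ≤-trans (≤-trans (m≤m+n (weight u v) _) (m≤m+n _ 0)) (m≤n+m _ (junction (u ∷ []) W))
  junction-++ʳ (u ∷ u′ ∷ U) V       W = ≤-trans (junction-++ʳ (u′ ∷ U) V W)
    (+-monoʳ-≤ (junction (u′ ∷ U) W) (m≤n+m (crossPairs (u′ ∷ U) V) (∑ (weight u) V)))

  farPairs₀-++₄ : ∀ X U V Y → farPairs 0 (X ++ U ++ V ++ Y) ≡
    farPairs 0 X + (farPairs 0 U + (farPairs 0 V + farPairs 0 Y + crossPairs V Y) + (crossPairs U V + crossPairs U Y))
      + (crossPairs X U + (crossPairs X V + crossPairs X Y))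
  farPairs₀-++₄ X U V Y = trans (farPairs₀-++ X (U ++ V ++ Y))
    (cong₂ (λ a b → farPairs 0 X + a + b)
      (trans (farPairs₀-++ U (V ++ Y)) (cong₂ (λ a b → farPairs 0 U + a + b) (farPairs₀-++ V Y) (crossPairs-++ʳ U V Y)))
      (trans (crossPairs-++ʳ X U (V ++ Y)) (cong (crossPairs X U +_) (crossPairs-++ʳ X V Y))))

  farPairs₀-exchange : ∀ X U V Y →
    farPairs 0 (X ++ U ++ V ++ Y) + crossPairs V U ≡ farPairs 0 (X ++ V ++ U ++ Y) + crossPairs U V
  farPairs₀-exchange X U V Y = begin
    farPairs 0 (X ++ U ++ V ++ Y) + crossPairs V U ≡⟨ cong (_+ crossPairs V U) (farPairs₀-++₄ X U V Y) ⟩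
    _                                              ≡⟨ regroup (farPairs 0 X) (farPairs 0 U) (farPairs 0 V) (farPairs 0 Y)
                                                        (crossPairs V Y) (crossPairs U V) (crossPairs U Y)
                                                        (crossPairs X U) (crossPairs X V) (crossPairs X Y) (crossPairs V U) ⟩
    _                                              ≡⟨ cong (_+ crossPairs U V) (farPairs₀-++₄ X V U Y) ⟨
    farPairs 0 (X ++ V ++ U ++ Y) + crossPairs U V ∎
    where
    open ≡-Reasoning
    regroup : ∀ x u v y vy uv uy xu xv xy vu →
      (x + (u + (v + y + vy) + (uv + uy)) + (xu + (xv + xy))) + vu ≡
      (x + (v + (u + y + uy) + (vu + vy)) + (xv + (xu + xy))) + uv
    regroup = solve-∀

  adjacentPairs-++₄ : ∀ X U V Y → adjacentPairs (X ++ U ++ V ++ Y) ≡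
    adjacentPairs X + (adjacentPairs U + (adjacentPairs V + adjacentPairs Y + junction V Y) + junction U (V ++ Y))
      + junction X (U ++ V ++ Y)
  adjacentPairs-++₄ X U V Y = trans (adjacentPairs-++ X (U ++ V ++ Y))
    (cong (λ a → adjacentPairs X + a + junction X (U ++ V ++ Y))
      (trans (adjacentPairs-++ U (V ++ Y)) (cong (λ a → adjacentPairs U + a + junction U (V ++ Y)) (adjacentPairs-++ V Y))))

  adjacentPairs-exchange : ∀ X U V Y →
    adjacentPairs (X ++ V ++ U ++ Y) ≤ adjacentPairs (X ++ U ++ V ++ Y) + 2 + crossPairs V U
  adjacentPairs-exchange X U V Y = begin
    adjacentPairs (X ++ V ++ U ++ Y)
      ≡⟨ adjacentPairs-++₄ X V U Y ⟩
    x + (v + (u + y + junction U Y) + junction V (U ++ Y)) + junction X (V ++ U ++ Y)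
      ≤⟨ +-mono-≤ (+-monoʳ-≤ x (+-mono-≤ (+-monoʳ-≤ v (+-monoʳ-≤ (u + y) (junction≤1 U Y))) (junction-++ʳ V U Y)))
                  (junction≤1 X (V ++ U ++ Y)) ⟩
    x + (v + (u + y + 1) + (vy + vu)) + 1
      ≡⟨ regroup x u v y vy vu ⟩
    x + (u + (v + y + vy)) + 2 + vu
      ≤⟨ +-monoˡ-≤ vu (+-monoˡ-≤ 2 (≤-trans (+-monoʳ-≤ x (m≤m+n _ (junction U (V ++ Y))))
                                            (m≤m+n _ (junction X (U ++ V ++ Y))))) ⟩
    x + (u + (v + y + vy) + junction U (V ++ Y)) + junction X (U ++ V ++ Y) + 2 + vu
      ≡⟨ cong (λ a → a + 2 + vu) (adjacentPairs-++₄ X U V Y) ⟨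
    adjacentPairs (X ++ U ++ V ++ Y) + 2 + crossPairs V U ∎
    where
    open ≤-Reasoning
    x = adjacentPairs X
    u = adjacentPairs U
    v = adjacentPairs V
    y = adjacentPairs Y
    vy = junction V Y
    vu = crossPairs V U
    regroup : ∀ x u v y vy vu → x + (v + (u + y + 1) + (vy + vu)) + 1 ≡ x + (u + (v + y + vy)) + 2 + vu
    regroup = solve-∀

  farPairs₀-exchange-≤ : ∀ X U V Y →
    farPairs 0 (X ++ U ++ V ++ Y) ≤ farPairs 0 (X ++ V ++ U ++ Y) + crossPairs U V
  farPairs₀-exchange-≤ X U V Y =
    ≤-trans (m≤m+n _ (crossPairs V U)) (≤-reflexive (farPairs₀-exchange X U V Y))

  farPairs₁-exchange-≤ : ∀ X U V Y → crossPairs U V ≡ 0 →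
    farPairs 1 (X ++ U ++ V ++ Y) ≤ farPairs 1 (X ++ V ++ U ++ Y) + 2
  farPairs₁-exchange-≤ X U V Y noCross = +-cancelʳ-≤ (a + c) g (g′ + 2) (begin
    g + (a + c)                    ≡⟨ +-assoc g a c ⟨
    g + a + c                      ≡⟨ cong (_+ c) (farPairs₁+adjacentPairs σ) ⟩
    farPairs 0 σ + c               ≡⟨ farPairs₀-exchange X U V Y ⟩
    farPairs 0 σ′ + crossPairs U V ≡⟨ cong (farPairs 0 σ′ +_) noCross ⟩
    farPairs 0 σ′ + 0              ≡⟨ +-identityʳ _ ⟩
    farPairs 0 σ′                  ≡⟨ farPairs₁+adjacentPairs σ′ ⟨
    g′ + a′                        ≤⟨ +-monoʳ-≤ g′ (adjacentPairs-exchange X U V Y) ⟩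
    g′ + (a + 2 + c)               ≡⟨ regroup g′ a c ⟩
    g′ + 2 + (a + c)               ∎)
    where
    open ≤-Reasoning
    σ = X ++ U ++ V ++ Y
    σ′ = X ++ V ++ U ++ Y
    g = farPairs 1 σ
    g′ = farPairs 1 σ′
    a = adjacentPairs σ
    a′ = adjacentPairs σ′
    c = crossPairs V U
    regroup : ∀ g a c → g + (a + 2 + c) ≡ g + 2 + (a + c)
    regroup = solve-∀

-- Inverse descents and inverse gaps as pair counts

isSuccOf : ℕ → ℕ → Bool
isSuccOf x y = does (x ≟ suc y)

∑<-drop : ∀ (g : ℕ → ℕ) d xs → ∑< (length xs) (λ q → g (at xs q) * 𝟙 (does (d <? suc q))) ≡ ∑ g (drop d xs)
∑<-drop g zero    xs       = trans (∑<-cong (λ q → *-identityʳ (g (at xs q))) (length xs)) (∑<-at g xs)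
∑<-drop g (suc d) []       = refl
∑<-drop g (suc d) (y ∷ ys) = cong₂ _+_ (*-zeroʳ (g y)) (∑<-drop g d ys)

-- The offset is written p + d, not d + p, so that the indicator reduces as p and q are shifted.
farPairs-positions : ∀ (R : ℕ → ℕ → Bool) d σ →
  ∑< (length σ) (λ p → ∑< (length σ) (λ q → 𝟙 (R (at σ p) (at σ q)) * 𝟙 (does (p + d <? q)))) ≡ farPairs R d σ
farPairs-positions R d []       = refl
farPairs-positions R d (x ∷ xs) = cong₂ _+_
  (cong₂ _+_ (*-zeroʳ (weight R x x)) (∑<-drop (weight R x) d xs))
  (trans (∑<-cong (λ p → cong (_+ ∑< (length xs) (λ q → weight R (at xs p) (at xs q) * 𝟙 (does (p + d <? q))))
                                     (*-zeroʳ (weight R (at xs p) x))) (length xs)) (farPairs-positions R d xs))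

invDes-farPairs : ∀ n π → invDes n π ≡ farPairs isSuccOf 0 (extend n π)
invDes-farPairs n π = begin
  invDes n π
    ≡⟨ length-filter-pairs (λ (p , q) → (at σ p ≟ suc (at σ q)) ×-dec (p <? q)) σ ⟩
  ∑< L (λ p → ∑< L (λ q → 𝟙 (isSuccOf (at σ p) (at σ q) ∧ does (p <? q))))
    ≡⟨ ∑<-cong (λ p → ∑<-cong (λ q → 𝟙-∧-<? (isSuccOf (at σ p) (at σ q)) q (sym (+-identityʳ p))) L) L ⟩
  ∑< L (λ p → ∑< L (λ q → weight isSuccOf (at σ p) (at σ q) * 𝟙 (does (p + 0 <? q))))
    ≡⟨ farPairs-positions isSuccOf 0 σ ⟩
  farPairs isSuccOf 0 σ ∎
  where
  open ≡-Reasoning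
  σ = extend n π
  L = length σ

invGap-farPairs : ∀ n π → invGap n π ≡ farPairs (flip isSuccOf) 1 (extend n π)
invGap-farPairs n π = begin
  invGap n π
    ≡⟨ length-filter-pairs (λ (p , q) → (at σ p ≟ suc (at σ q)) ×-dec (suc q <? p)) σ ⟩
  ∑< L (λ p → ∑< L (λ q → 𝟙 (isSuccOf (at σ p) (at σ q) ∧ does (suc q <? p))))
    ≡⟨ ∑<-comm (λ p q → 𝟙 (isSuccOf (at σ p) (at σ q) ∧ does (suc q <? p))) L L ⟩
  ∑< L (λ q → ∑< L (λ p → 𝟙 (isSuccOf (at σ p) (at σ q) ∧ does (suc q <? p))))
    ≡⟨ ∑<-cong (λ q → ∑<-cong (λ p → 𝟙-∧-<? (isSuccOf (at σ p) (at σ q)) p (+-comm 1 q)) L) L ⟩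
  ∑< L (λ q → ∑< L (λ p → weight (flip isSuccOf) (at σ q) (at σ p) * 𝟙 (does (q + 1 <? p))))
    ≡⟨ farPairs-positions (flip isSuccOf) 1 σ ⟩
  farPairs (flip isSuccOf) 1 σ ∎
  where
  open ≡-Reasoning
  σ = extend n π
  L = length σ

_≻_ : List ℕ → List ℕ → Set
U ≻ V = All (λ u → All (_< u) V) U

-- If u = v + 1 with u ∈ U, v ∈ V and U ≻ V, then u = min U and v = max V.
crossPairs-isSuccOf-≤1 : ∀ {U V} → Unique U → Unique V → U ≻ V → crossPairs isSuccOf U V ≤ 1
crossPairs-isSuccOf-≤1 {U} {V} uniqueU uniqueV U≻V = ∑-≤1 uniqueU row≤1 sameRow
  where
  row≤1 : ∀ u → ∑ (weight isSuccOf u) V ≤ 1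
  row≤1 u = ∑-≤1 uniqueV (λ v → 𝟙≤1 (isSuccOf u v))
    (λ _ _ 0<fv 0<fv′ → suc-injective (trans (sym (𝟙-does-witness (u ≟ suc _) 0<fv)) (𝟙-does-witness (u ≟ suc _) 0<fv′)))
  sameRow : ∀ {u u′} → u ∈ U → u′ ∈ U → 0 < ∑ (weight isSuccOf u) V → 0 < ∑ (weight isSuccOf u′) V → u ≡ u′
  sameRow {u} {u′} u∈U u′∈U 0<row 0<row′ with ∑-positive V 0<row | ∑-positive V 0<row′
  ... | v , v∈V , 0<w | v′ , v′∈V , 0<w′ = ≤-antisym (below u∈U v∈V 0<w u′∈U) (below u′∈U v′∈V 0<w′ u∈U)
    where
    below : ∀ {u v u′} → u ∈ U → v ∈ V → 0 < weight isSuccOf u v → u′ ∈ U → u ≤ u′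
    below {u} {v} {u′} u∈U v∈V 0<w u′∈U rewrite 𝟙-does-witness (u ≟ suc v) 0<w =
      All.lookup (All.lookup U≻V u′∈U) v∈V

crossPairs-isSuccOf-≡0 : ∀ {U V} → U ≻ V → crossPairs (flip isSuccOf) U V ≡ 0
crossPairs-isSuccOf-≡0 {U} {V} U≻V = ∑-zero U λ u∈U → ∑-zero V λ {v} v∈V →
  𝟙-does-no (v ≟ suc _) λ v≡1+u → <-asym (All.lookup (All.lookup U≻V u∈U) v∈V) (≤-reflexive (sym v≡1+u))

IsPerm⇒Unique : ∀ {n π} → IsPerm n π → Unique π
IsPerm⇒Unique {n} perm =
  Unique-resp-↭ (↭⇒↭ₛ (↭-sym perm)) (applyUpTo⁺₁ suc n (λ i<j _ → <⇒≢ i<j ∘ suc-injective))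

take++drop-take : ∀ {A : Set} {m n} (xs : List A) → m ≤ n → take m xs ++ drop m (take n xs) ≡ take n xs
take++drop-take {m = m} {n} xs m≤n = begin
  take m xs ++ drop m (take n xs)          ≡⟨ cong (λ l → take l xs ++ drop m (take n xs)) (m≤n⇒m⊓n≡m m≤n) ⟨
  take (m ⊓ n) xs ++ drop m (take n xs)    ≡⟨ cong (_++ drop m (take n xs)) (take-take m n xs) ⟨
  take m (take n xs) ++ drop m (take n xs) ≡⟨ take++drop≡id m (take n xs) ⟩
  take n xs                                ∎
  where open ≡-Reasoning

take++slices++drop≡id : ∀ (π : List ℕ) {i j k} → i ∸ 1 ≤ j → j ≤ k →
  take (i ∸ 1) π ++ slice π i j ++ slice π (suc j) k ++ drop k π ≡ π
take++slices++drop≡id π {i} {j} {k} i≤j j≤k = begin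
  P ++ U ++ V ++ D       ≡⟨ cong (P ++_) (++-assoc U V D) ⟨
  P ++ (U ++ V) ++ D     ≡⟨ ++-assoc P (U ++ V) D ⟨
  (P ++ U ++ V) ++ D     ≡⟨ cong (_++ D) (++-assoc P U V) ⟨
  ((P ++ U) ++ V) ++ D   ≡⟨ cong (λ l → (l ++ V) ++ D) (take++drop-take π i≤j) ⟩
  (take j π ++ V) ++ D   ≡⟨ cong (_++ D) (take++drop-take π j≤k) ⟩
  take k π ++ D          ≡⟨ take++drop≡id k π ⟩
  π                      ∎
  where
  open ≡-Reasoning
  P = take (i ∸ 1) π
  U = slice π i j
  V = slice π (suc j) k
  D = drop k π

extend-++ : ∀ n (P U V D : List ℕ) → extend n (P ++ U ++ V ++ D) ≡ (0 ∷ P) ++ U ++ V ++ (D ++ [ suc n ])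
extend-++ n P U V D = cong (0 ∷_) (begin
  (P ++ U ++ V ++ D) ++ E ≡⟨ ++-assoc P (U ++ V ++ D) E ⟩
  P ++ (U ++ V ++ D) ++ E ≡⟨ cong (P ++_) (++-assoc U (V ++ D) E) ⟩
  P ++ U ++ (V ++ D) ++ E ≡⟨ cong (λ l → P ++ U ++ l) (++-assoc V D E) ⟩
  P ++ U ++ V ++ D ++ E   ∎)
  where
  open ≡-Reasoning
  E = [ suc n ]

lemma2 : (n : ℕ) (π : List ℕ) → IsPerm n π →
    (i j k : ℕ) → ValidBM n i j k → Monotone π i j k →
    (invDes n π ≤ invDes n (blockMove π i j k) + 1) ×
    (invGap n π ≤ invGap n (blockMove π i j k) + 2)
lemma2 n π perm i j k (_ , i≤j , j<k , _) U≻V = descents , gaps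
  where
  open ≤-Reasoning
  P = take (i ∸ 1) π
  U = slice π i j
  V = slice π (suc j) k
  D = drop k π
  X = 0 ∷ P
  Y = D ++ [ suc n ]
  before : extend n π ≡ X ++ U ++ V ++ Y
  before = trans (cong (extend n) (sym (take++slices++drop≡id π {i} (≤-trans (m∸n≤m i 1) i≤j) (<⇒≤ j<k))))
                 (extend-++ n P U V D)
  after : extend n (blockMove π i j k) ≡ X ++ V ++ U ++ Y
  after = extend-++ n P V U D
  uniqueπ = IsPerm⇒Unique perm
  descents = begin
    invDes n π                                      ≡⟨ invDes-farPairs n π ⟩
    farPairs isSuccOf 0 (extend n π)                ≡⟨ cong (farPairs isSuccOf 0) before ⟩
    farPairs isSuccOf 0 (X ++ U ++ V ++ Y)          ≤⟨ farPairs₀-exchange-≤ isSuccOf X U V Y ⟩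
    farPairs isSuccOf 0 (X ++ V ++ U ++ Y) + crossPairs isSuccOf U V
      ≤⟨ +-monoʳ-≤ _ (crossPairs-isSuccOf-≤1 (drop⁺ (i ∸ 1) (take⁺ j uniqueπ)) (drop⁺ j (take⁺ k uniqueπ)) U≻V) ⟩
    farPairs isSuccOf 0 (X ++ V ++ U ++ Y) + 1      ≡⟨ cong (λ σ → farPairs isSuccOf 0 σ + 1) after ⟨
    farPairs isSuccOf 0 (extend n (blockMove π i j k)) + 1
      ≡⟨ cong (_+ 1) (invDes-farPairs n (blockMove π i j k)) ⟨
    invDes n (blockMove π i j k) + 1                ∎
  gaps = begin
    invGap n π                                      ≡⟨ invGap-farPairs n π ⟩
    farPairs (flip isSuccOf) 1 (extend n π)         ≡⟨ cong (farPairs (flip isSuccOf) 1) before ⟩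
    farPairs (flip isSuccOf) 1 (X ++ U ++ V ++ Y)
      ≤⟨ farPairs₁-exchange-≤ (flip isSuccOf) X U V Y (crossPairs-isSuccOf-≡0 U≻V) ⟩
    farPairs (flip isSuccOf) 1 (X ++ V ++ U ++ Y) + 2 ≡⟨ cong (λ σ → farPairs (flip isSuccOf) 1 σ + 2) after ⟨
    farPairs (flip isSuccOf) 1 (extend n (blockMove π i j k)) + 2
      ≡⟨ cong (_+ 2) (invGap-farPairs n (blockMove π i j k)) ⟨
    invGap n (blockMove π i j k) + 2                ∎
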